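{- Let $\mathcal{G}$ be a rectangular dualizable graph. For all adjacent vertices $v_i$ and $v_j$ of $\mathcal{G}$, $s=|N(v_i)\cap N(v_j)|\leq 2$.
   Context: All graphs considered are connected plane graphs whose interior faces (regions) are all triangles. A planar graph is a rectangular dualizable graph (RDG) if its dual graph can be realized as a rectangular floorplan (a partition of a rectangle into rectangles such that no four of them meet at a point); equivalently its dual is a plane graph whose edges can be oriented horizontally or vertically, with four-sided internal regions and a rectangular enclosure. $N(v)$ denotes the set of neighbours of $v$. In particular, an RDG contains no separating triangle (a 3-cycle enclosing at least one vertex inside and having at least one vertex outside). -}

module Defs where

open import Data.Nat using (ℕ)
open import Data.Bool using (Bool; true)
open import Data.Fin using (Fin)
open import Data.Fin.Subset using (Subset)
open import Data.Vec using (tabulate)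
open import Data.Rational using (ℚ; _<_; _≤_)
open import Data.Product using (Σ; ∃; _×_)
open import Data.Sum using (_⊎_)
open import Data.Empty using (⊥)
open import Relation.Binary.PropositionalEquality using (_≡_; _≢_)
open import Function.Bundles using (_⇔_)

record Rect : Set where
  field
    x₁ x₂ y₁ y₂ : ℚ
    x₁<x₂ : x₁ < x₂
    y₁<y₂ : y₁ < y₂
open Rect public

_∈R_ : ℚ × ℚ → Rect → Set
_∈R_ (a Data.Product., b) r = (x₁ r ≤ a × a ≤ x₂ r) × (y₁ r ≤ b × b ≤ y₂ r)

_⊆R_ : Rect → Rect → Set
r ⊆R s = (x₁ s ≤ x₁ r × x₂ r ≤ x₂ s) × (y₁ s ≤ y₁ r × y₂ r ≤ y₂ s)

InteriorsDisjoint : Rect → Rect → Set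
InteriorsDisjoint r s = x₂ r ≤ x₁ s ⊎ x₂ s ≤ x₁ r ⊎ y₂ r ≤ y₁ s ⊎ y₂ s ≤ y₁ r

Distinct4 : {n : ℕ} → Fin n → Fin n → Fin n → Fin n → Set
Distinct4 i j k l = i ≢ j × i ≢ k × i ≢ l × j ≢ k × j ≢ l × k ≢ l

record Floorplan (n : ℕ) : Set where
  field
    outer    : Rect
    room     : Fin n → Rect
    inside   : ∀ i → room i ⊆R outer
    disjoint : ∀ i j → i ≢ j → InteriorsDisjoint (room i) (room j)
    cover    : ∀ p → p ∈R outer → ∃ λ i → p ∈R room i
    no4      : ∀ p i j k l → Distinct4 i j k l →
               p ∈R room i → p ∈R room j → p ∈R room k → p ∈R room l → ⊥
open Floorplan public

-- Two rooms are adjacent iff they share a boundary segment of positive length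
-- (a vertical or a horizontal one).
RectAdj : Rect → Rect → Set
RectAdj r s =
  ((x₂ r ≡ x₁ s ⊎ x₂ s ≡ x₁ r) × (y₁ r < y₂ s × y₁ s < y₂ r))
  ⊎ ((y₂ r ≡ y₁ s ⊎ y₂ s ≡ y₁ r) × (x₁ r < x₂ s × x₁ s < x₂ r))

Graph : ℕ → Set
Graph n = Fin n → Fin n → Bool

RDG : {n : ℕ} → Graph n → Set
RDG {n} G = Σ (Floorplan n) λ F → ∀ i j → (G i j ≡ true) ⇔ RectAdj (room F i) (room F j)

N : {n : ℕ} → Graph n → Fin n → Subset n
N G v = tabulate (G v)

-- Two rooms of a floorplan are adjacent along a wall segment, and every room
-- adjacent to both of them contains one of the two endpoints of that segment.
-- Three common neighbours would therefore put two of them at the same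
-- endpoint, where four rooms would meet.
module Submission where

open import Defs
open import Data.Product using (∃; ∃₂; _×_; _,_; swap)
open import Data.Sum using (_⊎_; inj₁; inj₂; map)
open import Data.Empty using (⊥; ⊥-elim)
open import Function using (_∘_)
open import Function.Bundles using (Equivalence)
open import Relation.Nullary using (¬_; yes; no)
open import Relation.Binary.PropositionalEquality using (_≡_; _≢_; refl; sym; trans)

module RectGeometry where

  open import Data.Rational using (ℚ; _<_; _≤_; _⊔_; _⊓_)
  open import Data.Rational.Properties
    using ( ≤-refl; ≤-reflexive; <⇒≤; <-irrefl; p≤p⊔q; p≤q⊔p; p⊓q≤p; p⊓q≤q; ⊔-lub; ⊓-glb
          ; p≤q⇒p⊔q≡q; p≥q⇒p⊔q≡p; p≤q⇒p⊓q≡p; p≥q⇒p⊓q≡q; module ≤-Reasoning )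
  open ≤-Reasoning

  record WallEnds (r s : Rect) : Set where
    field
      end₁ end₂ : ℚ × ℚ
      end₁∈r : end₁ ∈R r
      end₁∈s : end₁ ∈R s
      end₂∈r : end₂ ∈R r
      end₂∈s : end₂ ∈R s
      covers : ∀ k → RectAdj r k → RectAdj s k → end₁ ∈R k ⊎ end₂ ∈R k

  <-absurd : ∀ {a} {A : Set} → a < a → A
  <-absurd = ⊥-elim ∘ <-irrefl refl

  onBottomEdge : ∀ {x y} k → x₁ k ≤ x → x ≤ x₂ k → y ≡ y₁ k → (x , y) ∈R k
  onBottomEdge k l u refl = (l , u) , (≤-refl , <⇒≤ (y₁<y₂ k))

  onTopEdge : ∀ {x y} k → x₁ k ≤ x → x ≤ x₂ k → y ≡ y₂ k → (x , y) ∈R k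
  onTopEdge k l u refl = (l , u) , (<⇒≤ (y₁<y₂ k) , ≤-refl)

  module VerticalWall (i j : Rect) (wall : x₂ i ≡ x₁ j)
                      (y₁i<y₂j : y₁ i < y₂ j) (y₁j<y₂i : y₁ j < y₂ i) where

    bottom top : ℚ
    bottom = y₁ i ⊔ y₁ j
    top    = y₂ i ⊓ y₂ j

    top≡y₂i : y₂ i ≤ y₂ j → top ≡ y₂ i
    top≡y₂i = p≤q⇒p⊓q≡p

    top≡y₂j : y₂ j ≤ y₂ i → top ≡ y₂ j
    top≡y₂j = p≥q⇒p⊓q≡q

    bottom≡y₁i : y₁ j ≤ y₁ i → bottom ≡ y₁ i
    bottom≡y₁i = p≥q⇒p⊔q≡p

    bottom≡y₁j : y₁ i ≤ y₁ j → bottom ≡ y₁ j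
    bottom≡y₁j = p≤q⇒p⊔q≡q

    x₂i≤ : ∀ {a} → x₁ j ≤ a → x₂ i ≤ a
    x₂i≤ {a} x₁j≤a = begin x₂ i ≡⟨ wall ⟩ x₁ j ≤⟨ x₁j≤a ⟩ a ∎

    -- r|s abbreviates x₂ r ≡ x₁ s (s touches r from the right), r/s abbreviates
    -- y₂ r ≡ y₁ s (s touches r from above).
    covers : ∀ k → RectAdj i k → RectAdj j k → (x₂ i , bottom) ∈R k ⊎ (x₂ i , top) ∈R k
    covers k (inj₁ (inj₁ i|k , _)) (inj₁ (inj₁ j|k , _)) = <-absurd (begin-strict
      x₁ j <⟨ x₁<x₂ j ⟩ x₂ j ≡⟨ j|k ⟩ x₁ k ≡⟨ i|k ⟨ x₂ i ≡⟨ wall ⟩ x₁ j ∎)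
    covers k (inj₁ (inj₁ i|k , _)) (inj₁ (inj₂ k|j , _)) = <-absurd (begin-strict
      x₁ k <⟨ x₁<x₂ k ⟩ x₂ k ≡⟨ k|j ⟩ x₁ j ≡⟨ wall ⟨ x₂ i ≡⟨ i|k ⟩ x₁ k ∎)
    covers k (inj₁ (inj₁ i|k , _ , y₁k<y₂i)) (inj₂ (inj₁ j/k , x₁j<x₂k , _)) =
      inj₂ (onBottomEdge k (≤-reflexive (sym i|k)) (x₂i≤ (<⇒≤ x₁j<x₂k)) (trans (top≡y₂j
        (<⇒≤ (begin-strict y₂ j ≡⟨ j/k ⟩ y₁ k <⟨ y₁k<y₂i ⟩ y₂ i ∎))) j/k))
    covers k (inj₁ (inj₁ i|k , y₁i<y₂k , _)) (inj₂ (inj₂ k/j , x₁j<x₂k , _)) =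
      inj₁ (onTopEdge k (≤-reflexive (sym i|k)) (x₂i≤ (<⇒≤ x₁j<x₂k)) (trans (bottom≡y₁j
        (<⇒≤ (begin-strict y₁ i <⟨ y₁i<y₂k ⟩ y₂ k ≡⟨ k/j ⟩ y₁ j ∎))) (sym k/j)))
    covers k (inj₁ (inj₂ k|i , _)) (inj₁ (inj₁ j|k , _)) = <-absurd (begin-strict
      x₁ k <⟨ x₁<x₂ k ⟩ x₂ k ≡⟨ k|i ⟩ x₁ i <⟨ x₁<x₂ i ⟩ x₂ i ≡⟨ wall ⟩
      x₁ j <⟨ x₁<x₂ j ⟩ x₂ j ≡⟨ j|k ⟩ x₁ k ∎)
    covers k (inj₁ (inj₂ k|i , _)) (inj₁ (inj₂ k|j , _)) = <-absurd (begin-strict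
      x₁ i <⟨ x₁<x₂ i ⟩ x₂ i ≡⟨ wall ⟩ x₁ j ≡⟨ k|j ⟨ x₂ k ≡⟨ k|i ⟩ x₁ i ∎)
    covers k (inj₁ (inj₂ k|i , _)) (inj₂ (_ , x₁j<x₂k , _)) = <-absurd (begin-strict
      x₁ j <⟨ x₁j<x₂k ⟩ x₂ k ≡⟨ k|i ⟩ x₁ i <⟨ x₁<x₂ i ⟩ x₂ i ≡⟨ wall ⟩ x₁ j ∎)
    covers k (inj₂ (_ , _ , x₁k<x₂i)) (inj₁ (inj₁ j|k , _)) = <-absurd (begin-strict
      x₁ k <⟨ x₁k<x₂i ⟩ x₂ i ≡⟨ wall ⟩ x₁ j <⟨ x₁<x₂ j ⟩ x₂ j ≡⟨ j|k ⟩ x₁ k ∎)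
    covers k (inj₂ (inj₁ i/k , _ , x₁k<x₂i)) (inj₁ (inj₂ k|j , _ , y₁k<y₂j)) =
      inj₂ (onBottomEdge k (<⇒≤ x₁k<x₂i) (x₂i≤ (≤-reflexive (sym k|j))) (trans (top≡y₂i
        (<⇒≤ (begin-strict y₂ i ≡⟨ i/k ⟩ y₁ k <⟨ y₁k<y₂j ⟩ y₂ j ∎))) i/k))
    covers k (inj₂ (inj₁ i/k , _ , x₁k<x₂i)) (inj₂ (inj₁ j/k , x₁j<x₂k , _)) =
      inj₂ (onBottomEdge k (<⇒≤ x₁k<x₂i) (x₂i≤ (<⇒≤ x₁j<x₂k)) (trans (top≡y₂i
        (≤-reflexive (trans i/k (sym j/k)))) i/k))
    covers k (inj₂ (inj₁ i/k , _)) (inj₂ (inj₂ k/j , _)) = <-absurd (begin-strict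
      y₁ k <⟨ y₁<y₂ k ⟩ y₂ k ≡⟨ k/j ⟩ y₁ j <⟨ y₁j<y₂i ⟩ y₂ i ≡⟨ i/k ⟩ y₁ k ∎)
    covers k (inj₂ (inj₂ k/i , _ , x₁k<x₂i)) (inj₁ (inj₂ k|j , y₁j<y₂k , _)) =
      inj₁ (onTopEdge k (<⇒≤ x₁k<x₂i) (x₂i≤ (≤-reflexive (sym k|j))) (trans (bottom≡y₁i
        (<⇒≤ (begin-strict y₁ j <⟨ y₁j<y₂k ⟩ y₂ k ≡⟨ k/i ⟩ y₁ i ∎))) (sym k/i)))
    covers k (inj₂ (inj₂ k/i , _)) (inj₂ (inj₁ j/k , _)) = <-absurd (begin-strict
      y₁ k <⟨ y₁<y₂ k ⟩ y₂ k ≡⟨ k/i ⟩ y₁ i <⟨ y₁i<y₂j ⟩ y₂ j ≡⟨ j/k ⟩ y₁ k ∎)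
    covers k (inj₂ (inj₂ k/i , _ , x₁k<x₂i)) (inj₂ (inj₂ k/j , x₁j<x₂k , _)) =
      inj₁ (onTopEdge k (<⇒≤ x₁k<x₂i) (x₂i≤ (<⇒≤ x₁j<x₂k)) (trans (bottom≡y₁i
        (≤-reflexive (trans (sym k/j) k/i))) (sym k/i)))

    wallEnds : WallEnds i j
    wallEnds = record
      { end₁   = x₂ i , bottom
      ; end₂   = x₂ i , top
      ; end₁∈r = wall∈i , p≤p⊔q (y₁ i) (y₁ j) , ⊔-lub (<⇒≤ (y₁<y₂ i)) (<⇒≤ y₁j<y₂i)
      ; end₁∈s = wall∈j , p≤q⊔p (y₁ i) (y₁ j) , ⊔-lub (<⇒≤ y₁i<y₂j) (<⇒≤ (y₁<y₂ j))
      ; end₂∈r = wall∈i , ⊓-glb (<⇒≤ (y₁<y₂ i)) (<⇒≤ y₁i<y₂j) , p⊓q≤p (y₂ i) (y₂ j)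
      ; end₂∈s = wall∈j , ⊓-glb (<⇒≤ y₁j<y₂i) (<⇒≤ (y₁<y₂ j)) , p⊓q≤q (y₂ i) (y₂ j)
      ; covers = covers
      }
      where
      wall∈i : x₁ i ≤ x₂ i × x₂ i ≤ x₂ i
      wall∈i = <⇒≤ (x₁<x₂ i) , ≤-refl
      wall∈j : x₁ j ≤ x₂ i × x₂ i ≤ x₂ j
      wall∈j = ≤-reflexive (sym wall) , x₂i≤ (<⇒≤ (x₁<x₂ j))

  WallEnds-sym : ∀ {r s} → WallEnds r s → WallEnds s r
  WallEnds-sym w = record
    { end₁ = end₁ ; end₂ = end₂
    ; end₁∈r = end₁∈s ; end₁∈s = end₁∈r ; end₂∈r = end₂∈s ; end₂∈s = end₂∈r
    ; covers = λ k s~k r~k → covers k r~k s~k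
    }
    where open WallEnds w

  transpose : Rect → Rect
  transpose r = record
    { x₁ = y₁ r ; x₂ = y₂ r ; y₁ = x₁ r ; y₂ = x₂ r ; x₁<x₂ = y₁<y₂ r ; y₁<y₂ = x₁<x₂ r }

  RectAdj-transpose : ∀ {r s} → RectAdj r s → RectAdj (transpose r) (transpose s)
  RectAdj-transpose (inj₁ vertical)   = inj₂ vertical
  RectAdj-transpose (inj₂ horizontal) = inj₁ horizontal

  ∈R-transpose : ∀ {p r} → p ∈R transpose r → swap p ∈R r
  ∈R-transpose (x-bounds , y-bounds) = y-bounds , x-bounds

  WallEnds-untranspose : ∀ {r s} → WallEnds (transpose r) (transpose s) → WallEnds r s
  WallEnds-untranspose {r} {s} w = record
    { end₁ = swap end₁ ; end₂ = swap end₂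
    ; end₁∈r = ∈R-transpose {r = r} end₁∈r ; end₁∈s = ∈R-transpose {r = s} end₁∈s
    ; end₂∈r = ∈R-transpose {r = r} end₂∈r ; end₂∈s = ∈R-transpose {r = s} end₂∈s
    ; covers = λ k r~k s~k →
        map (∈R-transpose {r = k}) (∈R-transpose {r = k})
            (covers (transpose k) (RectAdj-transpose {r} {k} r~k)
                                  (RectAdj-transpose {s} {k} s~k))
    }
    where open WallEnds w

  RectAdj⇒WallEnds : ∀ {r s} → RectAdj r s → WallEnds r s
  RectAdj⇒WallEnds (inj₁ (inj₁ wall , a , b)) = VerticalWall.wallEnds _ _ wall a b
  RectAdj⇒WallEnds (inj₁ (inj₂ wall , a , b)) = WallEnds-sym (VerticalWall.wallEnds _ _ wall b a)
  RectAdj⇒WallEnds (inj₂ (inj₁ wall , a , b)) =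
    WallEnds-untranspose (VerticalWall.wallEnds _ _ wall a b)
  RectAdj⇒WallEnds (inj₂ (inj₂ wall , a , b)) =
    WallEnds-untranspose (WallEnds-sym (VerticalWall.wallEnds _ _ wall b a))

  RectAdj-irrefl : ∀ r → ¬ RectAdj r r
  RectAdj-irrefl r (inj₁ (inj₁ r|r , _)) = <-irrefl (sym r|r) (x₁<x₂ r)
  RectAdj-irrefl r (inj₁ (inj₂ r|r , _)) = <-irrefl (sym r|r) (x₁<x₂ r)
  RectAdj-irrefl r (inj₂ (inj₁ r/r , _)) = <-irrefl (sym r/r) (y₁<y₂ r)
  RectAdj-irrefl r (inj₂ (inj₂ r/r , _)) = <-irrefl (sym r/r) (y₁<y₂ r)

open RectGeometry using (WallEnds; RectAdj⇒WallEnds; RectAdj-irrefl)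
open import Data.Rational using (ℚ)
open import Data.Nat using (ℕ; _≤_; s≤s)
open import Data.Nat.Properties using (_≤?_; ≰⇒>)
open import Data.Bool using (true; false)
open import Data.Fin using (Fin; zero; suc)
open import Data.Fin.Properties using (suc-injective)
open import Data.Fin.Subset using (Subset; Nonempty; _∈_; _∩_; ∣_∣)
open import Data.Fin.Subset.Properties using (x∈p∩q⁻)
open import Data.Vec using (_∷_; here; there)
open import Data.Vec.Properties using ([]=⇒lookup; lookup∘tabulate)

AtMostOne : {A : Set} → (A → Set) → Set
AtMostOne P = ∀ {x y} → x ≢ y → P x → P y → ⊥

TwoDistinct ThreeDistinct : ∀ {n} → Subset n → Set
TwoDistinct p = ∃₂ λ x y → (x ∈ p × y ∈ p) × x ≢ y
ThreeDistinct p = ∃₂ λ x y → ∃ λ z → (x ∈ p × y ∈ p × z ∈ p) × (x ≢ y × x ≢ z × y ≢ z)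

1≤∣p∣⇒nonempty : ∀ {n} (p : Subset n) → 1 ≤ ∣ p ∣ → Nonempty p
1≤∣p∣⇒nonempty (true ∷ p) _ = zero , here
1≤∣p∣⇒nonempty (false ∷ p) 1≤∣p∣ with x , x∈p ← 1≤∣p∣⇒nonempty p 1≤∣p∣ = suc x , there x∈p

2≤∣p∣⇒twoDistinct : ∀ {n} (p : Subset n) → 2 ≤ ∣ p ∣ → TwoDistinct p
2≤∣p∣⇒twoDistinct (true ∷ p) (s≤s 1≤∣p∣) with x , x∈p ← 1≤∣p∣⇒nonempty p 1≤∣p∣ =
  zero , suc x , (here , there x∈p) , λ ()
2≤∣p∣⇒twoDistinct (false ∷ p) 2≤∣p∣
  with x , y , (x∈p , y∈p) , x≢y ← 2≤∣p∣⇒twoDistinct p 2≤∣p∣ =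
  suc x , suc y , (there x∈p , there y∈p) , x≢y ∘ suc-injective

3≤∣p∣⇒threeDistinct : ∀ {n} (p : Subset n) → 3 ≤ ∣ p ∣ → ThreeDistinct p
3≤∣p∣⇒threeDistinct (true ∷ p) (s≤s 2≤∣p∣)
  with x , y , (x∈p , y∈p) , x≢y ← 2≤∣p∣⇒twoDistinct p 2≤∣p∣ =
  zero , suc x , suc y , (here , there x∈p , there y∈p) , (λ ()) , (λ ()) , x≢y ∘ suc-injective
3≤∣p∣⇒threeDistinct (false ∷ p) 3≤∣p∣
  with x , y , z , (x∈p , y∈p , z∈p) , x≢y , x≢z , y≢z ← 3≤∣p∣⇒threeDistinct p 3≤∣p∣ =
  suc x , suc y , suc z , (there x∈p , there y∈p , there z∈p) ,
  x≢y ∘ suc-injective , x≢z ∘ suc-injective , y≢z ∘ suc-injective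

∣p∣≤2 : ∀ {n} {p : Subset n} {P Q : Fin n → Set} → AtMostOne P → AtMostOne Q →
        (∀ {x} → x ∈ p → P x ⊎ Q x) → ∣ p ∣ ≤ 2
∣p∣≤2 {p = p} P-unique Q-unique classify with ∣ p ∣ ≤? 2
... | yes ∣p∣≤2 = ∣p∣≤2
... | no ∣p∣≰2 = ⊥-elim (pigeonhole (3≤∣p∣⇒threeDistinct p (≰⇒> ∣p∣≰2)))
  where
  pigeonhole : ¬ ThreeDistinct p
  pigeonhole (x , y , z , (x∈p , y∈p , z∈p) , x≢y , x≢z , y≢z)
    with classify x∈p | classify y∈p | classify z∈p
  ... | inj₁ Px | inj₁ Py | _       = P-unique x≢y Px Py
  ... | inj₂ Qx | inj₂ Qy | _       = Q-unique x≢y Qx Qy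
  ... | inj₁ Px | _       | inj₁ Pz = P-unique x≢z Px Pz
  ... | inj₂ Qx | _       | inj₂ Qz = Q-unique x≢z Qx Qz
  ... | _       | inj₁ Py | inj₁ Pz = P-unique y≢z Py Pz
  ... | _       | inj₂ Qy | inj₂ Qz = Q-unique y≢z Qy Qz

module _ {n : ℕ} (F : Floorplan n) where

  Adjacent : Fin n → Fin n → Set
  Adjacent u v = RectAdj (room F u) (room F v)

  CommonNeighbourAt : Fin n → Fin n → ℚ × ℚ → Fin n → Set
  CommonNeighbourAt i j pt x = Adjacent i x × Adjacent j x × pt ∈R room F x

  Adjacent⇒≢ : ∀ {u v} → Adjacent u v → u ≢ v
  Adjacent⇒≢ {u} u~u refl = RectAdj-irrefl (room F u) u~u

  commonNeighbourAt-unique : ∀ {i j pt} → Adjacent i j → pt ∈R room F i → pt ∈R room F j →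
                             AtMostOne (CommonNeighbourAt i j pt)
  commonNeighbourAt-unique {i} {j} {pt} i~j pt∈i pt∈j {x} {y} x≢y
                           (i~x , j~x , pt∈x) (i~y , j~y , pt∈y) =
    no4 F pt i j x y distinct pt∈i pt∈j pt∈x pt∈y
    where
    distinct : Distinct4 i j x y
    distinct = Adjacent⇒≢ i~j , Adjacent⇒≢ i~x , Adjacent⇒≢ i~y
             , Adjacent⇒≢ j~x , Adjacent⇒≢ j~y , x≢y

∈N⇒edge : ∀ {n} (G : Graph n) {v x} → x ∈ N G v → G v x ≡ true
∈N⇒edge G {v} {x} x∈Nv = trans (sym (lookup∘tabulate (G v) x)) ([]=⇒lookup x∈Nv)

lemma4p2 : {n : ℕ} (G : Graph n) → RDG G →
    (i j : Fin n) → G i j ≡ true → ∣ N G i ∩ N G j ∣ ≤ 2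
lemma4p2 G (F , G⇔adjacent) i j ij∈G =
  ∣p∣≤2 (commonNeighbourAt-unique F i~j end₁∈r end₁∈s)
        (commonNeighbourAt-unique F i~j end₂∈r end₂∈s)
        atAnEnd
  where
  adjacent : ∀ {u v} → G u v ≡ true → Adjacent F u v
  adjacent {u} {v} = Equivalence.to (G⇔adjacent u v)

  i~j : Adjacent F i j
  i~j = adjacent ij∈G

  open WallEnds (RectAdj⇒WallEnds {room F i} {room F j} i~j)

  commonNeighbour : ∀ {x} → x ∈ N G i ∩ N G j → Adjacent F i x × Adjacent F j x
  commonNeighbour x∈N∩N with x∈Ni , x∈Nj ← x∈p∩q⁻ (N G i) (N G j) x∈N∩N =
    adjacent (∈N⇒edge G x∈Ni) , adjacent (∈N⇒edge G x∈Nj)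

  atAnEnd : ∀ {x} → x ∈ N G i ∩ N G j →
            CommonNeighbourAt F i j end₁ x ⊎ CommonNeighbourAt F i j end₂ x
  atAnEnd {x} x∈N∩N with i~x , j~x ← commonNeighbour x∈N∩N =
    map (λ end₁∈x → i~x , j~x , end₁∈x) (λ end₂∈x → i~x , j~x , end₂∈x)
        (covers (room F x) i~x j~x)
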